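{- Let $p$ be a prime and let $q$ and $m$ be powers of $p$ with $q>1$ and $m>1$. Let $E=\mathbb F_{q^m}\supset F=\mathbb F_q$, let $\sigma\colon E\to E$ be the map $x\mapsto x^q$, and let $T\colon E\to F$ be the trace map $T(x)=\sum_{j=0}^{m-1}x^{q^j}$. If $a\in E\setminus \ker T$ and $h\colon E\to E$ is the map $x\mapsto x^\sigma+a$, then the cyclic group $\langle h\rangle$ has order $pm$ and is semiregular on $E$.
   Context: A group $C$ of permutations of a set $X$ is semiregular if $x^c\ne x$ for all $x\in X$ and all $1\ne c\in C$. -}

module Defs where

open import Level using (_⊔_)
open import Data.Nat using (ℕ; zero; suc; _<_)
open import Data.Fin using (Fin)
open import Data.Product using (_×_; ∃)
open import Relation.Nullary using (¬_)
open import Algebra.Bundles using (CommutativeRing)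
open import Function.Bundles using (Bijection)
import Relation.Binary.PropositionalEquality as ≡

module _ {c ℓ} (R : CommutativeRing c ℓ) where
  open CommutativeRing R

  IsField : Set (c ⊔ ℓ)
  IsField = ¬ (0# ≈ 1#) × (∀ x → ¬ (x ≈ 0#) → ∃ λ y → x * y ≈ 1#)

  HasSize : ℕ → Set (c ⊔ ℓ)
  HasSize n = Bijection (≡.setoid (Fin n)) setoid

  pow : Carrier → ℕ → Carrier
  pow x zero    = 1#
  pow x (suc n) = x * pow x n

  sumTo : ℕ → (ℕ → Carrier) → Carrier
  sumTo zero    f = 0#
  sumTo (suc n) f = sumTo n f + f n

  frob : ℕ → Carrier → Carrier
  frob q x = pow x q

  trace : ℕ → ℕ → Carrier → Carrier
  trace q m x = sumTo m (λ j → pow x (q Data.Nat.^ j))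

  iter : (Carrier → Carrier) → ℕ → Carrier → Carrier
  iter f zero    x = x
  iter f (suc k) x = f (iter f k x)

  IsId : (Carrier → Carrier) → Set (c ⊔ ℓ)
  IsId g = ∀ x → g x ≈ x

  -- the cyclic group ⟨f⟩ has order n (n ≥ 1): f^n = id and f^k ≠ id for 0 < k < n
  CyclicOrder : (Carrier → Carrier) → ℕ → Set (c ⊔ ℓ)
  CyclicOrder f n = 0 < n × IsId (iter f n) × (∀ k → 0 < k → k < n → ¬ IsId (iter f k))

  -- ⟨f⟩ is semiregular: every non-identity element f^k fixes no point
  SemiregularCyclic : (Carrier → Carrier) → Set (c ⊔ ℓ)
  SemiregularCyclic f = ∀ k x → ¬ IsId (iter f k) → ¬ (iter f k x ≈ x)

module Submission where

-- In characteristic p the map σ is additive, and σ ^ m = id by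
-- Fermat's little theorem for the field of order q ^ m; hence h ^ m is the translation by T a, and
-- h ^ (n m) the translation by n T a.  So h ^ (p m) = id while h ^ m fixes no point.  The exponents k
-- with h ^ k x = x are closed under gcd (Bézout), and every proper divisor of p m = p ^ (1 + j)
-- divides m, so a point fixed by h ^ k with p m ∤ k would be fixed by h ^ m.

open import Defs
open import Level using (Level)
open import Data.Nat as ℕ using (ℕ; zero; suc; NonZero)
open import Data.Nat.Divisibility using (_∣_; divides; _∣?_; ∣⇒≤; ∣-refl)
open import Data.Nat.GCD using (gcd; gcd-GCD; gcd[m,n]∣m; gcd[m,n]∣n; module Bézout)
open import Data.Nat.Primality using (Prime; prime⇒nonZero)
open import Data.Nat.Combinatorics using (_C_; nCn≡1)
open import Data.Fin using (Fin; zero; suc; _≟_; toℕ; inject₁; fromℕ; punchIn)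
open import Data.Fin.Properties using (toℕ-fromℕ; inject₁ℕ<; punchInᵢ≢i)
open import Data.Fin.Permutation using (Permutation; permutation)
open import Data.Product using (_×_; _,_; proj₁; proj₂)
open import Data.Empty using (⊥-elim)
open import Function using (_∘_)
open import Function.Bundles using (Bijection)
open import Relation.Nullary using (¬_; yes; no)
open import Relation.Nullary.Decidable using (map′)
open import Relation.Binary.Bundles using (Setoid)
open import Relation.Binary.Definitions using (Decidable)
open import Algebra.Bundles using (CommutativeRing; CommutativeMonoid)
import Algebra.Properties.CommutativeMonoid.Sum as CommutativeMonoidSum
import Relation.Binary.PropositionalEquality as ≡
import Data.Nat.Properties as ℕₚ

module PrimeDivisibility where
  open import Data.Nat
  open import Data.Nat.Properties
  open import Data.Nat.Divisibility
  open import Data.Nat.Primality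
  open import Data.Nat.Coprimality using (Coprime; coprime-divisor)
  open import Data.Nat.Combinatorics using (k![n∸k]!∣n!)
  open import Data.Nat.Combinatorics.Specification using (nCk≡n!/k![n-k]!)
  open import Data.Nat.DivMod using (m*[n/m]≡n)
  open import Data.Sum using (inj₁; inj₂)
  open import Relation.Binary.PropositionalEquality

  1<m^n⇒n≢0 : ∀ {m n} → 1 < m ^ n → NonZero n
  1<m^n⇒n≢0 {n = zero}  (s≤s ())
  1<m^n⇒n≢0 {n = suc n} _ = _

  module _ {p : ℕ} (p-prime : Prime p) where
    private
      instance
        p≢0 : NonZero p
        p≢0 = prime⇒nonZero p-prime

      n∣n! : ∀ n .{{_ : NonZero n}} → n ∣ n !
      n∣n! (suc n) = m∣m*n (n !)

      ∤⇒coprime : ∀ {d} → p ∤ d → Coprime d p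
      ∤⇒coprime p∤d (i∣d , i∣p) with prime⇒irreducible p-prime i∣p
      ... | inj₁ i≡1  = i≡1
      ... | inj₂ refl = ⊥-elim (p∤d i∣d)

    p∤n! : ∀ {n} → n < p → p ∤ n !
    p∤n! {zero}  _   p∣1 = ¬prime[1] (subst Prime (∣1⇒≡1 p∣1) p-prime)
    p∤n! {suc n} n<p p∣n! with euclidsLemma (suc n) (n !) p-prime p∣n!
    ... | inj₁ p∣1+n = <⇒≱ n<p (∣⇒≤ p∣1+n)
    ... | inj₂ p∣n!  = p∤n! (<-trans (n<1+n n) n<p) p∣n!

    p∣pCk : ∀ {k} → 0 < k → k < p → p ∣ p C k
    p∣pCk {k} 0<k k<p with euclidsLemma (k ! * (p ∸ k) !) (p C k) p-prime p∣k![p∸k]!*pCk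
      where
      instance
        k![p∸k]!≢0 : NonZero (k ! * (p ∸ k) !)
        k![p∸k]!≢0 = k !* (p ∸ k) !≢0
      p∣k![p∸k]!*pCk : p ∣ k ! * (p ∸ k) ! * (p C k)
      p∣k![p∸k]!*pCk = subst (p ∣_)
        (sym (trans (cong (k ! * (p ∸ k) ! *_) (nCk≡n!/k![n-k]! (<⇒≤ k<p)))
                    (m*[n/m]≡n (k![n∸k]!∣n! (<⇒≤ k<p)))))
        (n∣n! p)
    ... | inj₂ p∣pCk = p∣pCk
    ... | inj₁ p∣k![p∸k]! with euclidsLemma (k !) ((p ∸ k) !) p-prime p∣k![p∸k]!
    ...   | inj₁ p∣k!     = ⊥-elim (p∤n! k<p p∣k!)
    ...   | inj₂ p∣[p∸k]! = ⊥-elim (p∤n! (∸-monoʳ-< 0<k (<⇒≤ k<p)) p∣[p∸k]!)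

    ∣p^[1+n]⇒∣p^n : ∀ n {d} → d ∣ p ^ suc n → d ≢ p ^ suc n → d ∣ p ^ n
    ∣p^[1+n]⇒∣p^n n {d} d∣p^[1+n] d≢p^[1+n] with p ∣? d
    ... | no p∤d = coprime-divisor (∤⇒coprime p∤d) d∣p^[1+n]
    ... | yes (divides e refl) =
      e*p∣p^n n (*-cancelʳ-∣ p (subst (e * p ∣_) (*-comm p (p ^ n)) d∣p^[1+n]))
                (λ { refl → d≢p^[1+n] (*-comm (p ^ n) p) })
      where
      e*p∣p^n : ∀ n → e ∣ p ^ n → e ≢ p ^ n → e * p ∣ p ^ n
      e*p∣p^n zero    e∣1     e≢1     = ⊥-elim (e≢1 (∣1⇒≡1 e∣1))
      e*p∣p^n (suc n) e∣p^n+1 e≢p^n+1 =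
        subst (e * p ∣_) (*-comm (p ^ n) p) (*-monoˡ-∣ p (∣p^[1+n]⇒∣p^n n e∣p^n+1 e≢p^n+1))

open PrimeDivisibility

module RingLemmas {c ℓ} (R : CommutativeRing c ℓ) where
  open CommutativeRing R
  open import Relation.Binary.Reasoning.Setoid setoid
  open import Algebra.Properties.Semiring.Exp semiring using (^-congˡ; ^-assocʳ) renaming (_^_ to _^ᴿ_)
  open import Algebra.Properties.Semiring.Mult semiring using (×1-homo-*; ×-assoc-*; ×-congʳ)
    renaming (_×_ to _·_)

  pow-cong : ∀ n {x y} → x ≈ y → pow R x n ≈ pow R y n
  pow-cong zero    _   = refl
  pow-cong (suc n) x≈y = *-cong x≈y (pow-cong n x≈y)

  pow≈^ : ∀ x n → pow R x n ≈ x ^ᴿ n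
  pow≈^ x zero    = refl
  pow≈^ x (suc n) = *-congˡ (pow≈^ x n)

  pow-pow : ∀ x a b → pow R (pow R x a) b ≈ pow R x (a ℕ.* b)
  pow-pow x a b = begin
    pow R (pow R x a) b  ≈⟨ pow≈^ (pow R x a) b ⟩
    pow R x a ^ᴿ b       ≈⟨ ^-congˡ b (pow≈^ x a) ⟩
    (x ^ᴿ a) ^ᴿ b        ≈⟨ ^-assocʳ x a b ⟩
    x ^ᴿ (a ℕ.* b)       ≈⟨ pow≈^ x (a ℕ.* b) ⟨
    pow R x (a ℕ.* b)    ∎

  ^·1≈pow : ∀ n e → (n ℕ.^ e) · 1# ≈ pow R (n · 1#) e
  ^·1≈pow n zero    = +-identityʳ 1#
  ^·1≈pow n (suc e) = trans (×1-homo-* n (n ℕ.^ e)) (*-congˡ (^·1≈pow n e))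

  ·≈·1* : ∀ n x → n · x ≈ (n · 1#) * x
  ·≈·1* n x = trans (×-congʳ n (sym (*-identityˡ x))) (sym (×-assoc-* n 1# x))

  iter-frob : ∀ q j x → iter R (frob R q) j x ≈ pow R x (q ℕ.^ j)
  iter-frob q zero    x = sym (*-identityʳ x)
  iter-frob q (suc j) x = begin
    pow R (iter R (frob R q) j x) q  ≈⟨ pow-cong q (iter-frob q j x) ⟩
    pow R (pow R x (q ℕ.^ j)) q      ≈⟨ pow-pow x (q ℕ.^ j) q ⟩
    pow R x (q ℕ.^ j ℕ.* q)          ≡⟨ ≡.cong (pow R x) (ℕₚ.*-comm (q ℕ.^ j) q) ⟩
    pow R x (q ℕ.^ suc j)            ∎

  sumTo-cong : ∀ k {f g : ℕ → Carrier} → (∀ j → f j ≈ g j) → sumTo R k f ≈ sumTo R k g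
  sumTo-cong zero    _   = refl
  sumTo-cong (suc k) f≈g = +-cong (sumTo-cong k f≈g) (f≈g k)

module Iterates {c ℓ} (R : CommutativeRing c ℓ) where
  open CommutativeRing R
  open import Relation.Binary.Reasoning.Setoid setoid
  open import Algebra.Properties.Ring ring using (+-identityʳ-unique)
  open import Algebra.Properties.Semiring.Mult semiring using () renaming (_×_ to _·_)

  iter-+ : ∀ (f : Carrier → Carrier) a b x → iter R f (a ℕ.+ b) x ≡.≡ iter R f a (iter R f b x)
  iter-+ f zero    b x = ≡.refl
  iter-+ f (suc a) b x = ≡.cong f (iter-+ f a b x)

  module _ {f : Carrier → Carrier} (f-cong : ∀ {x y} → x ≈ y → f x ≈ f y) where

    iter-cong : ∀ k {x y} → x ≈ y → iter R f k x ≈ iter R f k y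
    iter-cong zero    x≈y = x≈y
    iter-cong (suc k) x≈y = f-cong (iter-cong k x≈y)

    IsPeriod : Carrier → ℕ → Set ℓ
    IsPeriod x k = iter R f k x ≈ x

    module _ {x : Carrier} where

      period-+ : ∀ {a b} → IsPeriod x a → IsPeriod x b → IsPeriod x (a ℕ.+ b)
      period-+ {a} {b} a-period b-period =
        trans (reflexive (iter-+ f a b x)) (trans (iter-cong a b-period) a-period)

      period-∸ : ∀ {a b} → IsPeriod x (a ℕ.+ b) → IsPeriod x b → IsPeriod x a
      period-∸ {a} {b} a+b-period b-period =
        trans (iter-cong a (sym b-period)) (trans (reflexive (≡.sym (iter-+ f a b x))) a+b-period)

      period-* : ∀ {a} → IsPeriod x a → ∀ n → IsPeriod x (n ℕ.* a)
      period-*     a-period zero    = refl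
      period-* {a} a-period (suc n) = period-+ {a} {n ℕ.* a} a-period (period-* a-period n)

      period-gcd : ∀ {a b} → IsPeriod x a → IsPeriod x b → IsPeriod x (gcd a b)
      period-gcd {a} {b} a-period b-period with Bézout.identity (gcd-GCD a b)
      ... | Bézout.Identity.+- u v eq =
        period-∸ {gcd a b} {v ℕ.* b} (≡.subst (IsPeriod x) (≡.sym eq) (period-* a-period u))
                                     (period-* b-period v)
      ... | Bézout.Identity.-+ u v eq =
        period-∸ {gcd a b} {u ℕ.* a} (≡.subst (IsPeriod x) (≡.sym eq) (period-* b-period v))
                                     (period-* a-period u)

    iter-translation : ∀ {m t} → (∀ x → iter R f m x ≈ x + t)
      → ∀ n x → iter R f (n ℕ.* m) x ≈ x + n · t
    iter-translation         f^m≈+t zero    x = sym (+-identityʳ x)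
    iter-translation {m} {t} f^m≈+t (suc n) x = begin
      iter R f (m ℕ.+ n ℕ.* m) x        ≡⟨ iter-+ f m (n ℕ.* m) x ⟩
      iter R f m (iter R f (n ℕ.* m) x) ≈⟨ f^m≈+t _ ⟩
      iter R f (n ℕ.* m) x + t          ≈⟨ +-congʳ (iter-translation f^m≈+t n x) ⟩
      (x + n · t) + t                   ≈⟨ +-assoc x (n · t) t ⟩
      x + (n · t + t)                   ≈⟨ +-congˡ (+-comm (n · t) t) ⟩
      x + (t + n · t)                   ∎

    -- If p m ∤ k for a period k of x, then gcd k (p m) is a proper divisor of p m = p ^ (1 + j), so it
    -- divides m and m is a period of x too; but f ^ m moves every point by t ≉ 0.
    translation-root-period : ∀ {p j t} → Prime p → (∀ x → iter R f (p ℕ.^ j) x ≈ x + t)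
      → ¬ (t ≈ 0#) → p · t ≈ 0#
      → IsId R (iter R f (p ℕ.* p ℕ.^ j)) × (∀ k x → IsPeriod x k → p ℕ.* p ℕ.^ j ∣ k)
    translation-root-period {p} {j} {t} p-prime f^m≈+t t≉0 p·t≈0 = f^pm≈id , pm∣period
      where
      m = p ℕ.^ j
      f^pm≈id : IsId R (iter R f (p ℕ.* m))
      f^pm≈id x = trans (iter-translation f^m≈+t p x) (trans (+-congˡ p·t≈0) (+-identityʳ x))

      pm∣period : ∀ k x → IsPeriod x k → p ℕ.* m ∣ k
      pm∣period k x k-period with p ℕ.* m ∣? k
      ... | yes pm∣k = pm∣k
      ... | no  pm∤k with ∣p^[1+n]⇒∣p^n p-prime j (gcd[m,n]∣n k (p ℕ.* m))
                            (λ g≡pm → pm∤k (≡.subst (_∣ k) g≡pm (gcd[m,n]∣m k (p ℕ.* m))))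
      ...   | divides c m≡c*g =
        ⊥-elim (t≉0 (+-identityʳ-unique x t (trans (sym (f^m≈+t x)) m-period)))
        where
        m-period : IsPeriod x m
        m-period = ≡.subst (IsPeriod x) (≡.sym m≡c*g)
                     (period-* (period-gcd {a = k} {b = p ℕ.* m} k-period (f^pm≈id x)) c)

    cyclicOrder×semiregular : ∀ {n} → 0 ℕ.< n → IsId R (iter R f n)
      → (∀ k x → IsPeriod x k → n ∣ k)
      → CyclicOrder R f n × SemiregularCyclic R f
    cyclicOrder×semiregular {n} 0<n f^n≈id n∣period =
      (0<n , f^n≈id , λ k 0<k k<n f^k≈id →
        ℕₚ.<⇒≱ k<n (∣⇒≤ ⦃ ℕ.>-nonZero 0<k ⦄ (n∣period k 0# (f^k≈id 0#)))) ,
      λ k x f^k≉id k-period → f^k≉id (multiple-of-n-is-id (n∣period k x k-period))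
      where
      multiple-of-n-is-id : ∀ {k} → n ∣ k → IsId R (iter R f k)
      multiple-of-n-is-id (divides c ≡.refl) y = period-* (f^n≈id y) c

module FiniteSetoid {s ℓ} (S : Setoid s ℓ) {N : ℕ}
                    (enumeration : Bijection (≡.setoid (Fin N)) S) where
  open Setoid S
  open Bijection enumeration public
    using () renaming (to to enum; cong to enum-cong; injective to enum-injective)
  open Bijection enumeration using (strictlySurjective)

  index : Carrier → Fin N
  index y = proj₁ (strictlySurjective y)

  enum-index : ∀ y → enum (index y) ≈ y
  enum-index y = proj₂ (strictlySurjective y)

  ≈-dec : Decidable _≈_
  ≈-dec x y = map′
    (λ ix≡iy → trans (sym (enum-index x)) (trans (enum-cong ix≡iy) (enum-index y)))
    (λ x≈y → enum-injective (trans (enum-index x) (trans x≈y (sym (enum-index y)))))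
    (index x ≟ index y)

  module _ {m ℓm} (M : CommutativeMonoid m ℓm) where
    open CommutativeMonoid M using () renaming (Carrier to Carrierᴹ; _≈_ to _≈ᴹ_; trans to transᴹ)
    open CommutativeMonoidSum M using (sum; sum-permute; sum-cong-≋)

    sum-reindex : (g : Carrier → Carrierᴹ) → (∀ {x y} → x ≈ y → g x ≈ᴹ g y)
      → (φ ψ : Carrier → Carrier)
      → (∀ {x y} → x ≈ y → φ x ≈ φ y) → (∀ {x y} → x ≈ y → ψ x ≈ ψ y)
      → (∀ x → φ (ψ x) ≈ x) → (∀ x → ψ (φ x) ≈ x)
      → sum (g ∘ enum) ≈ᴹ sum (g ∘ φ ∘ enum)
    sum-reindex g g-cong φ ψ φ-cong ψ-cong φψ≈id ψφ≈id =
      transᴹ (sum-permute (g ∘ enum) π) (sum-cong-≋ (λ i → g-cong (enum-index (φ (enum i)))))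
      where
      π : Permutation N N
      π = permutation (index ∘ φ ∘ enum) (index ∘ ψ ∘ enum)
        (λ i → enum-injective (trans (enum-index _) (trans (φ-cong (enum-index _)) (φψ≈id (enum i)))))
        (λ i → enum-injective (trans (enum-index _) (trans (ψ-cong (enum-index _)) (ψφ≈id (enum i)))))

module FiniteRing {c ℓ} (R : CommutativeRing c ℓ) where
  open CommutativeRing R
  open import Relation.Binary.Reasoning.Setoid setoid
  open import Algebra.Properties.Ring ring using (+-identityˡ-unique)
  open import Algebra.Properties.Group +-group using (\\-leftDividesˡ; \\-leftDividesʳ)
  open import Algebra.Properties.Semiring.Mult semiring using () renaming (_×_ to _·_)
  open CommutativeMonoidSum +-commutativeMonoid using (sum; ∑-distrib-+; sum-replicate)

  -- Translation by 1# permutes the ring, so it does not change the sum of all elements.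
  size·1≈0 : ∀ {N} → HasSize R N → N · 1# ≈ 0#
  size·1≈0 {N} size = +-identityˡ-unique (N · 1#) Σ (sym Σ≈N·1+Σ)
    where
    open FiniteSetoid setoid size
    Σ : Carrier
    Σ = sum enum
    Σ≈N·1+Σ : Σ ≈ N · 1# + Σ
    Σ≈N·1+Σ = begin
      Σ                        ≈⟨ sum-reindex +-commutativeMonoid (λ y → y) (λ y≈y → y≈y)
                                    (1# +_) (- 1# +_) +-congˡ +-congˡ
                                    (\\-leftDividesˡ 1#) (\\-leftDividesʳ 1#) ⟩
      sum (λ i → 1# + enum i)  ≈⟨ ∑-distrib-+ (λ _ → 1#) enum ⟩
      sum {N} (λ _ → 1#) + Σ   ≈⟨ +-congʳ (sum-replicate N) ⟩
      N · 1# + Σ               ∎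

module FiniteField {c ℓ} (F : CommutativeRing c ℓ) (F-field : IsField F) where
  open CommutativeRing F hiding (zero)
  open import Relation.Binary.Reasoning.Setoid setoid
  open import Algebra.Properties.Semiring.Mult semiring using () renaming (_×_ to _·_)
  open CommutativeMonoidSum *-commutativeMonoid using (∑-distrib-+; sum-remove; sum-cong-≋)
    renaming (sum to ∏)
  open RingLemmas F using (^·1≈pow)
  open FiniteRing F using (size·1≈0)

  private
    module _ {x : Carrier} (x≉0 : x ≉ 0#) where
      x⁻¹ : Carrier
      x⁻¹ = proj₁ (proj₂ F-field x x≉0)

      x*x⁻¹≈1 : x * x⁻¹ ≈ 1#
      x*x⁻¹≈1 = proj₂ (proj₂ F-field x x≉0)

      x*[x⁻¹*y]≈y : ∀ y → x * (x⁻¹ * y) ≈ y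
      x*[x⁻¹*y]≈y y = trans (sym (*-assoc x x⁻¹ y)) (trans (*-congʳ x*x⁻¹≈1) (*-identityˡ y))

      x⁻¹*[x*y]≈y : ∀ y → x⁻¹ * (x * y) ≈ y
      x⁻¹*[x*y]≈y y =
        trans (sym (*-assoc x⁻¹ x y))
              (trans (*-congʳ (trans (*-comm x⁻¹ x) x*x⁻¹≈1)) (*-identityˡ y))

  *-≉0 : ∀ {x y} → x ≉ 0# → y ≉ 0# → x * y ≉ 0#
  *-≉0 {x} {y} x≉0 y≉0 xy≈0 = y≉0 (begin
    y                ≈⟨ x⁻¹*[x*y]≈y x≉0 y ⟨
    x⁻¹ x≉0 * (x * y) ≈⟨ *-congˡ xy≈0 ⟩
    x⁻¹ x≉0 * 0#      ≈⟨ zeroʳ _ ⟩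
    0#               ∎)

  *-cancelʳ-≉0 : ∀ {x y z} → z ≉ 0# → x * z ≈ y * z → x ≈ y
  *-cancelʳ-≉0 {x} {y} {z} z≉0 xz≈yz = begin
    x                      ≈⟨ x⁻¹*[x*y]≈y z≉0 x ⟨
    x⁻¹ z≉0 * (z * x)      ≈⟨ *-congˡ (trans (*-comm z x) (trans xz≈yz (*-comm y z))) ⟩
    x⁻¹ z≉0 * (z * y)      ≈⟨ x⁻¹*[x*y]≈y z≉0 y ⟩
    y                      ∎

  pow-≉0 : ∀ {x} n → x ≉ 0# → pow F x n ≉ 0#
  pow-≉0 zero    _   1≈0 = proj₁ F-field (sym 1≈0)
  pow-≉0 (suc n) x≉0     = *-≉0 x≉0 (pow-≉0 n x≉0)

  ∏-≉0 : ∀ {n} (f : Fin n → Carrier) → (∀ i → f i ≉ 0#) → ∏ f ≉ 0#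
  ∏-≉0 {zero}  f f≉0 1≈0 = proj₁ F-field (sym 1≈0)
  ∏-≉0 {suc n} f f≉0     = *-≉0 (f≉0 zero) (∏-≉0 (f ∘ suc) (f≉0 ∘ suc))

  ∏-replicate : ∀ n x → ∏ {n} (λ _ → x) ≈ pow F x n
  ∏-replicate zero    x = refl
  ∏-replicate (suc n) x = *-congˡ (∏-replicate n x)

  -- Lagrange for the unit group: multiplication by a unit x permutes the nonzero elements, whose
  -- product u therefore satisfies x ^ (N - 1) * u ≈ u.  Zero is kept in the product as the factor 1#.
  pow-pred-size≈1 : ∀ {n} → HasSize F (suc n) → ∀ {x} → x ≉ 0# → pow F x n ≈ 1#
  pow-pred-size≈1 {n} size {x} x≉0 = *-cancelʳ-≉0 (∏-≉0 u u≉0) (begin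
    pow F x n * ∏ u            ≈⟨ *-congʳ (∏-replicate n x) ⟨
    ∏ {n} (λ _ → x) * ∏ u      ≈⟨ ∑-distrib-+ (λ _ → x) u ⟨
    ∏ (λ j → x * u j)          ≈⟨ ∏ν (λ i → x * enum i) (trans (*-congˡ (enum-index 0#)) (zeroʳ x))
                                     (λ j → *-≉0 x≉0 (u≉0 j)) ⟨
    ∏ (λ i → ν (x * enum i))   ≈⟨ sum-reindex *-commutativeMonoid ν ν-cong (x *_) (x⁻¹ x≉0 *_)
                                     *-congˡ *-congˡ (x*[x⁻¹*y]≈y x≉0) (x⁻¹*[x*y]≈y x≉0) ⟨
    ∏ (ν ∘ enum)               ≈⟨ ∏ν enum (enum-index 0#) u≉0 ⟩
    ∏ u                        ≈⟨ *-identityˡ _ ⟨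
    1# * ∏ u                   ∎)
    where
    open FiniteSetoid setoid size
    z : Fin (suc n)
    z = index 0#

    u : Fin n → Carrier
    u = enum ∘ punchIn z

    u≉0 : ∀ j → u j ≉ 0#
    u≉0 j uj≈0 = punchInᵢ≢i z j (enum-injective (trans uj≈0 (sym (enum-index 0#))))

    ν : Carrier → Carrier
    ν y with ≈-dec y 0#
    ... | yes _ = 1#
    ... | no  _ = y

    ν-cong : ∀ {y y′} → y ≈ y′ → ν y ≈ ν y′
    ν-cong {y} {y′} y≈y′ with ≈-dec y 0# | ≈-dec y′ 0#
    ... | yes _   | yes _    = refl
    ... | no  _   | no  _    = y≈y′
    ... | yes y≈0 | no  y′≉0 = ⊥-elim (y′≉0 (trans (sym y≈y′) y≈0))
    ... | no  y≉0 | yes y′≈0 = ⊥-elim (y≉0 (trans y≈y′ y′≈0))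

    ν-≈0 : ∀ {y} → y ≈ 0# → ν y ≈ 1#
    ν-≈0 {y} y≈0 with ≈-dec y 0#
    ... | yes _   = refl
    ... | no  y≉0 = ⊥-elim (y≉0 y≈0)

    ν-≉0 : ∀ {y} → y ≉ 0# → ν y ≈ y
    ν-≉0 {y} y≉0 with ≈-dec y 0#
    ... | yes y≈0 = ⊥-elim (y≉0 y≈0)
    ... | no  _   = refl

    ∏ν : (w : Fin (suc n) → Carrier) → w z ≈ 0# → (∀ j → w (punchIn z j) ≉ 0#)
       → ∏ (ν ∘ w) ≈ ∏ (w ∘ punchIn z)
    ∏ν w wz≈0 w≉0 = trans (sum-remove {i = z} (ν ∘ w))
      (trans (*-cong (ν-≈0 wz≈0) (sum-cong-≋ (λ j → ν-≉0 (w≉0 j)))) (*-identityˡ _))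

  pow-size : ∀ {N} → HasSize F N → ∀ x → pow F x N ≈ x
  pow-size {zero}  size x with FiniteSetoid.index setoid size x
  ... | ()
  pow-size {suc n} size x with FiniteSetoid.≈-dec setoid size x 0#
  ... | yes x≈0 = trans (*-congʳ x≈0) (trans (zeroˡ _) (sym x≈0))
  ... | no  x≉0 = trans (*-congˡ (pow-pred-size≈1 size x≉0)) (*-identityʳ x)

  char-of-size : ∀ {N} n e .{{_ : NonZero e}} → HasSize F N → N ≡.≡ n ℕ.^ e → n · 1# ≈ 0#
  char-of-size {N} n e size N≡n^e with FiniteSetoid.≈-dec setoid size (n · 1#) 0#
  ... | yes n·1≈0 = n·1≈0
  ... | no  n·1≉0 = ⊥-elim (pow-≉0 e n·1≉0 (begin
    pow F (n · 1#) e  ≈⟨ ^·1≈pow n e ⟨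
    (n ℕ.^ e) · 1#    ≡⟨ ≡.cong (_· 1#) N≡n^e ⟨
    N · 1#            ≈⟨ size·1≈0 size ⟩
    0#                ∎))

module Frobenius {c ℓ} (R : CommutativeRing c ℓ) where
  open CommutativeRing R hiding (zero)
  open import Relation.Binary.Reasoning.Setoid setoid
  open import Algebra.Properties.Semiring.Exp semiring using () renaming (_^_ to _^ᴿ_)
  open import Algebra.Properties.Semiring.Mult semiring using (×-homo-1; ×-congˡ; ×1-homo-*)
    renaming (_×_ to _·_)
  open import Algebra.Properties.CommutativeSemiring.Binomial commutativeSemiring
    using (binomialTerm) renaming (theorem to binomial-theorem)
  open CommutativeMonoidSum +-commutativeMonoid using (sum; sum-init-last; sum-cong-≋; sum-replicate-zero)
  open RingLemmas R using (pow-cong; pow≈^; pow-pow; ·≈·1*)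

  pow-+-vanishing : ∀ n .{{_ : NonZero n}} → (∀ k x → 0 ℕ.< k → k ℕ.< n → (n C k) · x ≈ 0#)
    → ∀ x y → pow R (x + y) n ≈ pow R x n + pow R y n
  pow-+-vanishing (suc n) middle≈0 x y = begin
    pow R (x + y) (suc n)               ≈⟨ pow≈^ (x + y) (suc n) ⟩
    (x + y) ^ᴿ suc n                    ≈⟨ binomial-theorem (suc n) x y ⟩
    t zero + sum (t ∘ suc)              ≈⟨ +-congˡ (sum-init-last (t ∘ suc)) ⟩
    t zero + (sum (t ∘ suc ∘ inject₁) + t (suc (fromℕ n)))
      ≈⟨ +-cong first-term (+-cong middle-terms (last-term (toℕ (fromℕ n)) (toℕ-fromℕ n))) ⟩
    y ^ᴿ suc n + (0# + x ^ᴿ suc n)      ≈⟨ +-comm _ _ ⟩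
    (0# + x ^ᴿ suc n) + y ^ᴿ suc n      ≈⟨ +-congʳ (+-identityˡ _) ⟩
    x ^ᴿ suc n + y ^ᴿ suc n             ≈⟨ +-cong (pow≈^ x (suc n)) (pow≈^ y (suc n)) ⟨
    pow R x (suc n) + pow R y (suc n)   ∎
    where
    t : Fin (suc (suc n)) → Carrier
    t = binomialTerm x y (suc n)

    first-term : t zero ≈ y ^ᴿ suc n
    first-term = trans (×-homo-1 _) (*-identityˡ _)

    last-term : ∀ k → k ≡.≡ n → (suc n C suc k) · (x ^ᴿ suc k * y ^ᴿ (n ℕ.∸ k)) ≈ x ^ᴿ suc n
    last-term k ≡.refl = begin
      (suc n C suc n) · (x ^ᴿ suc n * y ^ᴿ (n ℕ.∸ n))  ≈⟨ ×-congˡ (nCn≡1 (suc n)) ⟩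
      1 · (x ^ᴿ suc n * y ^ᴿ (n ℕ.∸ n))               ≈⟨ ×-homo-1 _ ⟩
      x ^ᴿ suc n * y ^ᴿ (n ℕ.∸ n)                     ≡⟨ ≡.cong ((x ^ᴿ suc n *_) ∘ (y ^ᴿ_)) (ℕₚ.n∸n≡0 n) ⟩
      x ^ᴿ suc n * 1#                                 ≈⟨ *-identityʳ _ ⟩
      x ^ᴿ suc n                                      ∎

    middle-terms : sum (t ∘ suc ∘ inject₁) ≈ 0#
    middle-terms = trans (sum-cong-≋ (λ i → middle≈0 _ _ ℕ.z<s (ℕ.s<s (inject₁ℕ< i))))
                         (sum-replicate-zero n)

  module _ {p} (p-prime : Prime p) (char : p · 1# ≈ 0#) where
    private instance
      p≢0 : NonZero p
      p≢0 = prime⇒nonZero p-prime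

    p∣n⇒n·x≈0 : ∀ {n} x → p ∣ n → n · x ≈ 0#
    p∣n⇒n·x≈0 {n} x (divides c n≡c*p) = begin
      n · x                  ≈⟨ ·≈·1* n x ⟩
      (n · 1#) * x           ≡⟨ ≡.cong (λ k → (k · 1#) * x) n≡c*p ⟩
      ((c ℕ.* p) · 1#) * x   ≈⟨ *-congʳ (×1-homo-* c p) ⟩
      (c · 1#) * (p · 1#) * x ≈⟨ *-congʳ (*-congˡ char) ⟩
      (c · 1#) * 0# * x      ≈⟨ *-congʳ (zeroʳ _) ⟩
      0# * x                 ≈⟨ zeroˡ x ⟩
      0#                     ∎

    pow-p-+ : ∀ x y → pow R (x + y) p ≈ pow R x p + pow R y p
    pow-p-+ = pow-+-vanishing p (λ k x 0<k k<p → p∣n⇒n·x≈0 x (p∣pCk p-prime 0<k k<p))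

    pow-p^i-+ : ∀ i x y → pow R (x + y) (p ℕ.^ i) ≈ pow R x (p ℕ.^ i) + pow R y (p ℕ.^ i)
    pow-p^i-+ zero    x y = trans (*-identityʳ (x + y)) (sym (+-cong (*-identityʳ x) (*-identityʳ y)))
    pow-p^i-+ (suc i) x y = begin
      pow R (x + y) (p ℕ.* p ℕ.^ i)            ≈⟨ pow-pow (x + y) p (p ℕ.^ i) ⟨
      pow R (pow R (x + y) p) (p ℕ.^ i)        ≈⟨ pow-cong (p ℕ.^ i) (pow-p-+ x y) ⟩
      pow R (pow R x p + pow R y p) (p ℕ.^ i)  ≈⟨ pow-p^i-+ i _ _ ⟩
      pow R (pow R x p) (p ℕ.^ i) + pow R (pow R y p) (p ℕ.^ i)
        ≈⟨ +-cong (pow-pow x p _) (pow-pow y p _) ⟩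
      pow R x (p ℕ.* p ℕ.^ i) + pow R y (p ℕ.* p ℕ.^ i) ∎

module AffineMaps {c ℓ} (R : CommutativeRing c ℓ) where
  open CommutativeRing R
  open import Relation.Binary.Reasoning.Setoid setoid
  open import Algebra.Properties.Ring ring using (x+x≈x⇒x≈0)

  module AffineMap (σ : Carrier → Carrier) (σ-cong : ∀ {x y} → x ≈ y → σ x ≈ σ y)
                   (σ-+ : ∀ x y → σ (x + y) ≈ σ x + σ y) (a : Carrier) where

    h : Carrier → Carrier
    h x = σ x + a

    h-cong : ∀ {x y} → x ≈ y → h x ≈ h y
    h-cong x≈y = +-congʳ (σ-cong x≈y)

    orbit-sum : ℕ → Carrier
    orbit-sum k = sumTo R k (λ j → iter R σ j a)

    private
      σ-0 : σ 0# ≈ 0#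
      σ-0 = x+x≈x⇒x≈0 (σ 0#) (trans (sym (σ-+ 0# 0#)) (σ-cong (+-identityˡ 0#)))

      σ-orbit-sum : ∀ k → σ (orbit-sum k) + a ≈ orbit-sum (suc k)
      σ-orbit-sum zero    = +-congʳ σ-0
      σ-orbit-sum (suc k) = begin
        σ (orbit-sum k + iter R σ k a) + a        ≈⟨ +-congʳ (σ-+ _ _) ⟩
        (σ (orbit-sum k) + iter R σ (suc k) a) + a ≈⟨ +-assoc _ _ _ ⟩
        σ (orbit-sum k) + (iter R σ (suc k) a + a) ≈⟨ +-congˡ (+-comm _ _) ⟩
        σ (orbit-sum k) + (a + iter R σ (suc k) a) ≈⟨ +-assoc _ _ _ ⟨
        (σ (orbit-sum k) + a) + iter R σ (suc k) a ≈⟨ +-congʳ (σ-orbit-sum k) ⟩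
        orbit-sum (suc k) + iter R σ (suc k) a     ∎

    iter-h : ∀ k x → iter R h k x ≈ iter R σ k x + orbit-sum k
    iter-h zero    x = sym (+-identityʳ x)
    iter-h (suc k) x = begin
      σ (iter R h k x) + a                           ≈⟨ +-congʳ (σ-cong (iter-h k x)) ⟩
      σ (iter R σ k x + orbit-sum k) + a             ≈⟨ +-congʳ (σ-+ _ _) ⟩
      (iter R σ (suc k) x + σ (orbit-sum k)) + a     ≈⟨ +-assoc _ _ _ ⟩
      iter R σ (suc k) x + (σ (orbit-sum k) + a)     ≈⟨ +-congˡ (σ-orbit-sum k) ⟩
      iter R σ (suc k) x + orbit-sum (suc k)         ∎

open import Data.Nat using (_^_; _*_; _<_)
open import Data.Product using (∃)
open import Relation.Binary.PropositionalEquality using (_≡_; refl)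

lemma5p1 : ∀ {c ℓ : Level} (p q m : ℕ) → Prime p
    → (∃ λ i → q ≡ p ^ i) → (∃ λ j → m ≡ p ^ j) → 1 < q → 1 < m
    → (E : CommutativeRing c ℓ) → IsField E → HasSize E (q ^ m)
    → (a : CommutativeRing.Carrier E)
    → ¬ (CommutativeRing._≈_ E (trace E q m a) (CommutativeRing.0# E))
    → CyclicOrder E (λ x → CommutativeRing._+_ E (frob E q x) a) (p * m)
      × SemiregularCyclic E (λ x → CommutativeRing._+_ E (frob E q x) a)
lemma5p1 p .(p ^ i) .(p ^ j) p-prime (i , refl) (j , refl) 1<q _ E E-field E-size a trace≉0 =
  cyclicOrder×semiregular h-cong (ℕ.>-nonZero⁻¹ (p * p ^ j)) (proj₁ periods) (proj₂ periods)
  where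
  open CommutativeRing E using (_≈_; _+_; 0#; 1#; trans; +-cong)
  open import Algebra.Properties.Semiring.Mult (CommutativeRing.semiring E) using () renaming (_×_ to _·_)
  open RingLemmas E using (pow-cong; iter-frob; sumTo-cong)
  open FiniteField E E-field using (pow-size; char-of-size)
  open Frobenius E using (pow-p^i-+; p∣n⇒n·x≈0)
  open Iterates E using (cyclicOrder×semiregular; translation-root-period)
  instance
    p≢0 : NonZero p
    p≢0 = prime⇒nonZero p-prime
    i≢0 : NonZero i
    i≢0 = 1<m^n⇒n≢0 1<q
    m≢0 : NonZero (p ^ j)
    m≢0 = ℕₚ.m^n≢0 p j
    pm≢0 : NonZero (p * p ^ j)
    pm≢0 = ℕₚ.m*n≢0 p (p ^ j)

  char : p · 1# ≈ 0#
  char = char-of-size p (i * p ^ j) ⦃ ℕₚ.m*n≢0 i (p ^ j) ⦄ E-size (ℕₚ.^-*-assoc p i (p ^ j))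

  open AffineMaps.AffineMap E (frob E (p ^ i)) (pow-cong (p ^ i)) (pow-p^i-+ p-prime char i) a

  h^m≈+trace : ∀ x → iter E h (p ^ j) x ≈ x + trace E (p ^ i) (p ^ j) a
  h^m≈+trace x = trans (iter-h (p ^ j) x)
    (+-cong (trans (iter-frob (p ^ i) (p ^ j) x) (pow-size E-size x))
            (sumTo-cong (p ^ j) (λ k → iter-frob (p ^ i) k a)))

  periods : IsId E (iter E h (p * p ^ j)) × (∀ k x → iter E h k x ≈ x → p * p ^ j ∣ k)
  periods = translation-root-period h-cong {j = j} p-prime h^m≈+trace trace≉0
              (p∣n⇒n·x≈0 p-prime char _ ∣-refl)
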